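{- Let $G=(V,E)$ be a connected graph with a fixed spanning tree $T$, let $\alpha,\beta$ be proper 3-colourings of $G$, let $R=c_0,\dots,c_\ell$ be an $(\alpha\to\beta)$-recolouring and let $u$ be a vertex of $G$. Then $H_u^R(c_0,v)=0$ for each $v\in V$, and for each $i>0$ and each $v\in V$, $$H_u^R(c_i,v)-H_u^R(c_{i-1},v)=\begin{cases}0 & \text{if } c_i(v)=c_{i-1}(v),\\ 2 & \text{if } c_i(v)\equiv c_{i-1}(v)-1 \pmod 3,\\ -2 & \text{if } c_i(v)\equiv c_{i-1}(v)+1\pmod 3.\end{cases}$$
   Context: A proper 3-colouring is a map $c:V\to\{1,2,3\}$ with $c(x)\ne c(y)$ for all $xy\in E$. A $(c_0\to c_\ell)$-recolouring of length $\ell$ is a sequence $c_0,\dots,c_\ell$ of proper 3-colourings in which consecutive colourings disagree on at most one vertex. For an edge oriented from $x$ to $y$, $w(c,\overrightarrow{xy})\in\{ -1,1\}$ satisfies $w(c,\overrightarrow{xy})\equiv c(y)-c(x)\pmod 3$; path weights are sums of edge weights; $\overrightarrow{P_{uv}}$ is the $u$–$v$ path in $T$ oriented from $u$ to $v$; $h_{\alpha,u}(c,v)=w(c,\overrightarrow{P_{uv}})-w(\alpha,\overrightarrow{P_{uv}})$. The absolute height (indexed by position $i$ in $R$) is defined by: $H_u^R(c_0,u)=0$; for $i>0$, $H_u^R(c_i,u)=H_u^R(c_{i-1},u)$ if $c_i(u)=c_{i-1}(u)$, $=H_u^R(c_{i-1},u)+2$ if $c_i(u)\equiv c_{i-1}(u)-1\pmod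 3$, and $=H_u^R(c_{i-1},u)-2$ if $c_i(u)\equiv c_{i-1}(u)+1\pmod 3$; and for all $i\ge0$ and $v\in V$, $H_u^R(c_i,v)=H_u^R(c_i,u)+h_{\alpha,u}(c_i,v)$. -}

module Defs where

open import Data.Nat using (ℕ; zero; suc; _≤_)
open import Data.Fin using (Fin; zero; suc)
open import Data.Integer using (ℤ; +_; -_; _+_; _-_)
open import Data.List using (List; []; _∷_)
open import Data.List.Relation.Unary.AllPairs using (AllPairs)
open import Data.Product using (Σ; _×_; ∃)
open import Relation.Binary.PropositionalEquality using (_≡_; _≢_)
open import Relation.Nullary using (¬_)

record Graph (n : ℕ) : Set₁ where
  field
    E       : Fin n → Fin n → Set
    E-sym   : ∀ {x y} → E x y → E y x
    E-irrefl : ∀ {x} → ¬ E x x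
open Graph public

-- A walk from u to v: the list of vertices visited after u.
IsWalk : ∀ {n} → (Fin n → Fin n → Set) → Fin n → List (Fin n) → Fin n → Set
IsWalk E u []       v = u ≡ v
IsWalk E u (x ∷ xs) v = E u x × IsWalk E x xs v

IsPath : ∀ {n} → (Fin n → Fin n → Set) → Fin n → List (Fin n) → Fin n → Set
IsPath E u xs v = IsWalk E u xs v × AllPairs _≢_ (u ∷ xs)

Connected : ∀ {n} → Graph n → Set
Connected G = ∀ u v → ∃ λ xs → IsWalk (E G) u xs v

record SpanningTree {n : ℕ} (G : Graph n) : Set₁ where
  field
    T      : Graph n
    T⊆G    : ∀ {x y} → E T x y → E G x y
    path   : Fin n → Fin n → List (Fin n)
    path-ok : ∀ u v → IsPath (E T) u (path u v) v
    path-unique : ∀ u v xs → IsPath (E T) u xs v → xs ≡ path u v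
open SpanningTree public

-- 3-colourings, colours Fin 3 read as integers modulo 3.
Colouring : ℕ → Set
Colouring n = Fin n → Fin 3

Proper : ∀ {n} → Graph n → Colouring n → Set
Proper G c = ∀ {x y} → E G x y → c x ≢ c y

suc3 : Fin 3 → Fin 3
suc3 zero = suc zero
suc3 (suc zero) = suc (suc zero)
suc3 (suc (suc zero)) = zero

pred3 : Fin 3 → Fin 3
pred3 zero = suc (suc zero)
pred3 (suc zero) = zero
pred3 (suc (suc zero)) = suc zero

-- (c_0 → c_ℓ)-recolouring of length ℓ, given as c : ℕ → Colouring n,
-- only the entries c 0, …, c ℓ being relevant.
record IsRecolouring {n : ℕ} (G : Graph n) (α β : Colouring n) (ℓ : ℕ)
                     (c : ℕ → Colouring n) : Set where
  field
    proper : ∀ i → i ≤ ℓ → Proper G (c i)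
    start  : c 0 ≡ α
    end    : c ℓ ≡ β
    step   : ∀ i → suc i ≤ ℓ →
             Σ (Fin n) λ x → ∀ y → y ≢ x → c (suc i) y ≡ c i y

-- w(c, x→y) ∈ {-1,1} with w ≡ c(y) - c(x) (mod 3).
-- (Only used on edges of G, where c(x) ≠ c(y) for proper c; the value 0
-- for c(x) = c(y) is an arbitrary convention.)
w : Fin 3 → Fin 3 → ℤ
w zero zero = + 0
w zero (suc zero) = + 1
w zero (suc (suc zero)) = - (+ 1)
w (suc zero) zero = - (+ 1)
w (suc zero) (suc zero) = + 0
w (suc zero) (suc (suc zero)) = + 1
w (suc (suc zero)) zero = + 1
w (suc (suc zero)) (suc zero) = - (+ 1)
w (suc (suc zero)) (suc (suc zero)) = + 0

edgeWeight : ∀ {n} → Colouring n → Fin n → Fin n → ℤ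
edgeWeight c x y = w (c x) (c y)

pathWeight : ∀ {n} → Colouring n → Fin n → List (Fin n) → ℤ
pathWeight c u []       = + 0
pathWeight c u (x ∷ xs) = edgeWeight c u x + pathWeight c x xs

h : ∀ {n} {G : Graph n} → SpanningTree G → Colouring n → Fin n →
    Colouring n → Fin n → ℤ
h T α u c v = pathWeight c u (path T u v) - pathWeight α u (path T u v)

Δ : Fin 3 → Fin 3 → ℤ
Δ zero zero = + 0
Δ zero (suc zero) = - (+ 2)
Δ zero (suc (suc zero)) = + 2
Δ (suc zero) zero = + 2
Δ (suc zero) (suc zero) = + 0
Δ (suc zero) (suc (suc zero)) = - (+ 2)
Δ (suc (suc zero)) zero = - (+ 2)
Δ (suc (suc zero)) (suc zero) = + 2
Δ (suc (suc zero)) (suc (suc zero)) = + 0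

-- H_u^R(c_i, u), indexed by position i in R
Hu : ∀ {n} → (ℕ → Colouring n) → Fin n → ℕ → ℤ
Hu c u zero    = + 0
Hu c u (suc i) = Hu c u i + Δ (c i u) (c (suc i) u)

H : ∀ {n} {G : Graph n} → SpanningTree G → Colouring n →
    (ℕ → Colouring n) → Fin n → ℕ → Fin n → ℤ
H T α c u i v = Hu c u i + h T α u (c i) v

-- A single recolouring step changes one vertex x, so on every edge at least one
-- endpoint keeps its colour; a three-colour check then shows that the change of
-- the edge weight is exactly the difference of the height changes Δ of its two
-- endpoints. Summing along the tree path P_uv telescopes, so the change of
-- h_{α,u}(·, v) is Δ at v minus Δ at u, and adding the change Δ at u of the
-- absolute height of u leaves Δ at v.
module Submission where

open import Defs
open import Data.Nat using (ℕ; suc; _≤_)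
open import Data.Nat.Properties using (≤-trans; n≤1+n)
open import Data.Fin using (Fin; zero; suc; _≟_)
open import Data.Fin.Properties using (all?)
open import Data.Integer using (+_; -_; _-_; _+_)
import Data.Integer as ℤ
open import Data.Integer.Properties using (+-identityˡ; +-identityʳ; +-inverseʳ)
open import Data.Integer.Tactic.RingSolver using (solve-∀)
open import Data.Product using (_×_; _,_; proj₁)
open import Data.Sum using (_⊎_; inj₁; inj₂)
open import Data.Empty using (⊥-elim)
open import Data.List using ([]; _∷_)
open import Relation.Nullary using (yes; no; ¬?)
open import Relation.Nullary.Decidable using (toWitness; _→-dec_)
open import Relation.Binary.PropositionalEquality
open import Function using (_∘_)

w-antisym : ∀ a b → w b a ≡ - w a b
w-antisym = toWitness {a? = all? λ a → all? λ b → w b a ℤ.≟ - w a b} _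

w-shiftʳ : ∀ a b b′ → a ≢ b → a ≢ b′ → w a b′ - w a b ≡ Δ b b′
w-shiftʳ = toWitness {a? = all? λ a → all? λ b → all? λ b′ →
  ¬? (a ≟ b) →-dec ¬? (a ≟ b′) →-dec (w a b′ - w a b ℤ.≟ Δ b b′)} _

Δ-refl : ∀ a → Δ a a ≡ + 0
Δ-refl zero             = refl
Δ-refl (suc zero)       = refl
Δ-refl (suc (suc zero)) = refl

Δ-pred3 : ∀ a → Δ a (pred3 a) ≡ + 2
Δ-pred3 zero             = refl
Δ-pred3 (suc zero)       = refl
Δ-pred3 (suc (suc zero)) = refl

Δ-suc3 : ∀ a → Δ a (suc3 a) ≡ - (+ 2)
Δ-suc3 zero             = refl
Δ-suc3 (suc zero)       = refl
Δ-suc3 (suc (suc zero)) = refl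

Δ-along-edge : ∀ a b a′ b′ → a ≢ b → a′ ≢ b′ → a ≡ a′ ⊎ b ≡ b′ →
               Δ a a′ + (w a′ b′ - w a b) ≡ Δ b b′
Δ-along-edge a b .a b′ a≢b a≢b′ (inj₁ refl) = begin
  Δ a a + (w a b′ - w a b) ≡⟨ cong (_+ (w a b′ - w a b)) (Δ-refl a) ⟩
  + 0 + (w a b′ - w a b)   ≡⟨ +-identityˡ _ ⟩
  w a b′ - w a b           ≡⟨ w-shiftʳ a b b′ a≢b a≢b′ ⟩
  Δ b b′                   ∎
  where open ≡-Reasoning
Δ-along-edge a b a′ .b a≢b a′≢b (inj₂ refl) = begin
  Δ a a′ + (w a′ b - w a b)      ≡⟨ cong₂ (λ p q → Δ a a′ + (p - q)) (w-antisym b a′) (w-antisym b a) ⟩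
  Δ a a′ + (- w b a′ - - w b a)  ≡⟨ regroup (Δ a a′) (w b a′) (w b a) ⟩
  Δ a a′ - (w b a′ - w b a)      ≡⟨ cong (λ x → Δ a a′ - x) (w-shiftʳ b a a′ (a≢b ∘ sym) (a′≢b ∘ sym)) ⟩
  Δ a a′ - Δ a a′                ≡⟨ +-inverseʳ (Δ a a′) ⟩
  + 0                            ≡⟨ Δ-refl b ⟨
  Δ b b                          ∎
  where
  open ≡-Reasoning
  regroup : ∀ d p q → d + (- p - - q) ≡ d - (p - q)
  regroup = solve-∀

StepCoherent : ∀ {n} → (Fin n → Fin n → Set) → Colouring n → Colouring n → Set
StepCoherent E c c′ = ∀ {x y} → E x y →
  Δ (c x) (c′ x) + (edgeWeight c′ x y - edgeWeight c x y) ≡ Δ (c y) (c′ y)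

pathWeight-telescope : ∀ {n} {E : Fin n → Fin n → Set} {c c′ : Colouring n} →
  StepCoherent E c c′ → ∀ u xs v → IsWalk E u xs v →
  Δ (c u) (c′ u) + (pathWeight c′ u xs - pathWeight c u xs) ≡ Δ (c v) (c′ v)
pathWeight-telescope coh u [] .u refl = +-identityʳ _
pathWeight-telescope {c = c} {c′} coh u (y ∷ xs) v (uy , walk) = begin
  Δ (c u) (c′ u) + (edgeWeight c′ u y + pathWeight c′ y xs - (edgeWeight c u y + pathWeight c y xs))
    ≡⟨ regroup (Δ (c u) (c′ u)) (edgeWeight c′ u y) (pathWeight c′ y xs) (edgeWeight c u y) (pathWeight c y xs) ⟩
  Δ (c u) (c′ u) + (edgeWeight c′ u y - edgeWeight c u y) + (pathWeight c′ y xs - pathWeight c y xs)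
    ≡⟨ cong (_+ (pathWeight c′ y xs - pathWeight c y xs)) (coh uy) ⟩
  Δ (c y) (c′ y) + (pathWeight c′ y xs - pathWeight c y xs)
    ≡⟨ pathWeight-telescope {c = c} {c′} coh y xs v walk ⟩
  Δ (c v) (c′ v) ∎
  where
  open ≡-Reasoning
  regroup : ∀ d e′ p′ e p → d + (e′ + p′ - (e + p)) ≡ d + (e′ - e) + (p′ - p)
  regroup = solve-∀

edge-keeps-an-endpoint : ∀ {n} (G : Graph n) {c c′ : Colouring n} {x : Fin n} →
  (∀ y → y ≢ x → c′ y ≡ c y) → ∀ {u y} → E G u y → c u ≡ c′ u ⊎ c y ≡ c′ y
edge-keeps-an-endpoint G {x = x} same {u} {y} uy with y ≟ x
... | no y≢x = inj₂ (sym (same y y≢x))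
... | yes refl with u ≟ y
...   | yes refl = ⊥-elim (E-irrefl G uy)
...   | no u≢y   = inj₁ (sym (same u u≢y))

single-vertex-step-coherent : ∀ {n} (G : Graph n) {c c′ : Colouring n} {x : Fin n} →
  Proper G c → Proper G c′ → (∀ y → y ≢ x → c′ y ≡ c y) → StepCoherent (E G) c c′
single-vertex-step-coherent G c-proper c′-proper same xy =
  Δ-along-edge _ _ _ _ (c-proper xy) (c′-proper xy) (edge-keeps-an-endpoint G same xy)

module _ {n} {G : Graph n} (T : SpanningTree G) (α : Colouring n)
         (c : ℕ → Colouring n) (u : Fin n) where

  H-start : c 0 ≡ α → ∀ v → H T α c u 0 v ≡ + 0
  H-start refl v = trans (+-identityˡ _) (+-inverseʳ (pathWeight α u (path T u v)))

  H-suc-difference : ∀ i v → let P = path T u v in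
    H T α c u (suc i) v - H T α c u i v ≡
    Δ (c i u) (c (suc i) u) + (pathWeight (c (suc i)) u P - pathWeight (c i) u P)
  H-suc-difference i v = regroup (Hu c u i) (Δ (c i u) (c (suc i) u))
    (pathWeight (c (suc i)) u (path T u v)) (pathWeight (c i) u (path T u v))
    (pathWeight α u (path T u v))
    where
    regroup : ∀ hᵤ d p′ p a → hᵤ + d + (p′ - a) - (hᵤ + (p - a)) ≡ d + (p′ - p)
    regroup = solve-∀

  H-step : ∀ i → StepCoherent (E G) (c i) (c (suc i)) → ∀ v →
    H T α c u (suc i) v - H T α c u i v ≡ Δ (c i v) (c (suc i) v)
  H-step i coh v = trans (H-suc-difference i v)
    (pathWeight-telescope {c = c i} {c (suc i)} (coh ∘ T⊆G T) u (path T u v) v (proj₁ (path-ok T u v)))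

lemma7 : ∀ {n} (G : Graph n) → Connected G → (T : SpanningTree G) →
         (α β : Colouring n) → Proper G α → Proper G β →
         (ℓ : ℕ) (c : ℕ → Colouring n) → IsRecolouring G α β ℓ c →
         (u : Fin n) →
         (∀ v → H T α c u 0 v ≡ + 0) ×
         (∀ i v → suc i ≤ ℓ →
            (c (suc i) v ≡ c i v → H T α c u (suc i) v - H T α c u i v ≡ + 0) ×
            (c (suc i) v ≡ pred3 (c i v) → H T α c u (suc i) v - H T α c u i v ≡ + 2) ×
            (c (suc i) v ≡ suc3 (c i v) → H T α c u (suc i) v - H T α c u i v ≡ - (+ 2)))
lemma7 G _ T α _ _ _ ℓ c R u = H-start T α c u start , λ i v i<ℓ →
  let ΔH = H-step T α c u i (coherent i i<ℓ) v
      a  = c i v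
  in (λ e → trans ΔH (trans (cong (Δ a) e) (Δ-refl a)))
   , (λ e → trans ΔH (trans (cong (Δ a) e) (Δ-pred3 a)))
   , (λ e → trans ΔH (trans (cong (Δ a) e) (Δ-suc3 a)))
  where
  open IsRecolouring R
  coherent : ∀ i → suc i ≤ ℓ → StepCoherent (E G) (c i) (c (suc i))
  coherent i i<ℓ with step i i<ℓ
  ... | _ , same = single-vertex-step-coherent G (proper i (≤-trans (n≤1+n i) i<ℓ)) (proper (suc i) i<ℓ) same
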